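{- Let $k\ge4$ and $m=\lfloor\frac{k-1}{2}\rfloor$. In $\mathbb{Z}[x,y]$ let $H_1(k)=\sum_{j=0}^{2k-2}y^j+x$, $H_2(k)=y^{2k-2}+x\sum_{j=0}^{2k-2}y^j$, $H_3(k)=y+\sum_{i=0}^{2k-2}x^i$, $H_4(k)=y\sum_{i=0}^{2k-2}x^i+x^{2k-2}$, and $C_1(k)=\sum_{j=0}^{k}y^j+\sum_{i=1}^{k-1}x^i+m\,xy-m$, $C_2(k)=\sum_{i=0}^{k}x^i+\sum_{j=1}^{k-1}y^j+m\,xy-m$, $C_3(k)=x^2y+xy-x-1$, $C_4(k)=xy^2+xy-y-1$, $C_5(k)=(k-2)xy-(k-2)$. Then $H_1(k),\dots,H_4(k)$ belong to the ideal of $\mathbb{Z}[x,y]$ generated by $C_1(k),\dots,C_5(k)$. -}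

module Defs where

open import Data.Nat as ℕ using (ℕ; zero; suc; _∸_; _/_)
open import Data.Integer as ℤ using (ℤ; +_; -_)
open import Data.List using (List; []; _∷_; map; foldr; upTo; zipWith)
open import Data.Product using (Σ-syntax)
open import Relation.Binary.PropositionalEquality using (_≡_)

-- Dense polynomials over a coefficient type, as coefficient lists
-- (constant term first). Generic over zero, addition, multiplication.

module PolyOps {A : Set} (0A : A) (_+A_ _*A_ : A → A → A) where

  infixl 6 _⊕_
  infixl 7 _⊗_

  _⊕_ : List A → List A → List A
  []      ⊕ q       = q
  (a ∷ p) ⊕ []      = a ∷ p
  (a ∷ p) ⊕ (b ∷ q) = (a +A b) ∷ (p ⊕ q)

  scale : A → List A → List A
  scale a = map (a *A_)

  _⊗_ : List A → List A → List A
  []      ⊗ q = []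
  (a ∷ p) ⊗ q = scale a q ⊕ (0A ∷ (p ⊗ q))

  coeff : List A → ℕ → A
  coeff []      _       = 0A
  coeff (a ∷ p) zero    = a
  coeff (a ∷ p) (suc i) = coeff p i

Poly₁ : Set
Poly₁ = List ℤ

module P₁ = PolyOps {ℤ} (+ 0) ℤ._+_ ℤ._*_

-- ℤ[x,y] = (ℤ[y])[x] : outer list indexed by the degree in x,
-- inner lists by the degree in y.
Poly : Set
Poly = List Poly₁

module P₂ = PolyOps {Poly₁} [] P₁._⊕_ P₁._⊗_

infixl 6 _+_
infixl 7 _*_
infixr 8 _^_
infix 4 _≈_

_+_ : Poly → Poly → Poly
_+_ = P₂._⊕_

_*_ : Poly → Poly → Poly
_*_ = P₂._⊗_

coeff : Poly → ℕ → ℕ → ℤ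
coeff p i j = P₁.coeff (P₂.coeff p i) j

_≈_ : Poly → Poly → Set
p ≈ q = ∀ i j → coeff p i j ≡ coeff q i j

const : ℤ → Poly
const c = (c ∷ []) ∷ []

X : Poly
X = [] ∷ (+ 1 ∷ []) ∷ []

Y : Poly
Y = (+ 0 ∷ + 1 ∷ []) ∷ []

_^_ : Poly → ℕ → Poly
p ^ zero  = const (+ 1)
p ^ suc n = p * (p ^ n)

sumL : List Poly → Poly
sumL = foldr _+_ []

-- Σ_{i=lo}^{hi} f i  (empty if hi < lo)
Σ[_to_] : ℕ → ℕ → (ℕ → Poly) → Poly
Σ[ lo to hi ] f = sumL (map (λ t → f (lo ℕ.+ t)) (upTo (suc hi ∸ lo)))

InIdeal : Poly → List Poly → Set
InIdeal h gs = Σ[ as ∈ List Poly ] (h ≈ sumL (zipWith _*_ as gs))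

m : ℕ → ℕ
m k = (k ∸ 1) / 2

H₁ H₂ H₃ H₄ : ℕ → Poly
H₁ k = Σ[ 0 to 2 ℕ.* k ∸ 2 ] (λ j → Y ^ j) + X
H₂ k = Y ^ (2 ℕ.* k ∸ 2) + X * Σ[ 0 to 2 ℕ.* k ∸ 2 ] (λ j → Y ^ j)
H₃ k = Y + Σ[ 0 to 2 ℕ.* k ∸ 2 ] (λ i → X ^ i)
H₄ k = Y * Σ[ 0 to 2 ℕ.* k ∸ 2 ] (λ i → X ^ i) + X ^ (2 ℕ.* k ∸ 2)

C₁ C₂ C₃ C₄ C₅ : ℕ → Poly
C₁ k = Σ[ 0 to k ] (λ j → Y ^ j) + Σ[ 1 to k ∸ 1 ] (λ i → X ^ i)
       + const (+ m k) * X * Y + const (- (+ m k))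
C₂ k = Σ[ 0 to k ] (λ i → X ^ i) + Σ[ 1 to k ∸ 1 ] (λ j → Y ^ j)
       + const (+ m k) * X * Y + const (- (+ m k))
C₃ k = X ^ 2 * Y + X * Y + const (- (+ 1)) * X + const (- (+ 1))
C₄ k = X * Y ^ 2 + X * Y + const (- (+ 1)) * Y + const (- (+ 1))
C₅ k = const (+ (k ∸ 2)) * X * Y + const (- (+ (k ∸ 2)))

gens : ℕ → List Poly
gens k = C₁ k ∷ C₂ k ∷ C₃ k ∷ C₄ k ∷ C₅ k ∷ []

-- Put u = x y − 1. The generators C₃, C₄, C₅ are (x + 1) u, (y + 1) u and (k − 2) u,
-- so modulo the ideal y u ≡ −u ≡ x u. Hence y^i x^(i+1) ≡ x − i u, and summing
-- these relations telescopes C₁ (resp. C₂) into H₁ (resp. H₃); H₂ and H₄ follow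
-- because H₂ − H₁ = (1 + y + ⋯ + y^(2k−3)) u, a sum of multiples of (y + 1) u.
module Submission where

import Defs
open import Level using (0ℓ)
open import Data.Nat as ℕ using (ℕ; zero; suc; _∸_; ⌊_/2⌋; ⌈_/2⌉; _≤_; s≤s; z≤n)
import Data.Nat.Properties as ℕ
open import Data.Nat.DivMod using (m/n≡1+[m∸n]/n)
open import Data.List using (List; []; _∷_; map; zipWith; applyUpTo)
open import Data.List.Properties using (map-upTo)
open import Data.List.Membership.Propositional using (_∈_)
open import Data.List.Relation.Unary.Any using (here; there)
open import Data.Maybe using (Maybe; just; nothing)
open import Data.Product using (Σ-syntax; _×_; _,_)
open import Algebra.Bundles using (CommutativeRing)
open import Algebra.Structures using (IsCommutativeRing)
open import Relation.Binary.Structures using (IsEquivalence)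
open import Relation.Binary.PropositionalEquality as ≡ using (_≡_)
open import Relation.Nullary using (yes; no)
open import Data.Integer as ℤ using (+_)
import Data.Integer.Properties as ℤ
import Algebra.Solver.Ring.AlmostCommutativeRing as ACR

module CoefficientLists {ℓ} (R : CommutativeRing 0ℓ ℓ) where
  open CommutativeRing R
  open Defs.PolyOps 0# _+_ _*_
  open import Algebra.Properties.Group +-group using (ε⁻¹≈ε)
  open import Relation.Binary.Reasoning.Setoid setoid

  infix 4 _≈ₚ_
  record _≈ₚ_ (p q : List Carrier) : Set ℓ where
    constructor mk
    field at : ∀ i → coeff p i ≈ coeff q i
  open _≈ₚ_

  negₚ : List Carrier → List Carrier
  negₚ = map (-_)

  ≈ₚ-isEquivalence : IsEquivalence _≈ₚ_
  ≈ₚ-isEquivalence = record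
    { refl  = mk λ i → refl
    ; sym   = λ p≈q → mk λ i → sym (at p≈q i)
    ; trans = λ p≈q q≈r → mk λ i → trans (at p≈q i) (at q≈r i)
    }

  open IsEquivalence ≈ₚ-isEquivalence using () renaming (refl to reflₚ; sym to symₚ; trans to transₚ)

  ∷-cong : ∀ {a b p q} → a ≈ b → p ≈ₚ q → a ∷ p ≈ₚ b ∷ q
  ∷-cong a≈b p≈q = mk λ { zero → a≈b ; (suc i) → at p≈q i }

  coeff-⊕ : ∀ p q i → coeff (p ⊕ q) i ≈ coeff p i + coeff q i
  coeff-⊕ []      q       i       = sym (+-identityˡ _)
  coeff-⊕ (a ∷ p) []      i       = sym (+-identityʳ _)
  coeff-⊕ (a ∷ p) (b ∷ q) zero    = refl
  coeff-⊕ (a ∷ p) (b ∷ q) (suc i) = coeff-⊕ p q i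

  coeff-scale : ∀ a p i → coeff (scale a p) i ≈ a * coeff p i
  coeff-scale a []      i       = sym (zeroʳ a)
  coeff-scale a (b ∷ p) zero    = refl
  coeff-scale a (b ∷ p) (suc i) = coeff-scale a p i

  coeff-negₚ : ∀ p i → coeff (negₚ p) i ≈ - coeff p i
  coeff-negₚ []      i       = sym ε⁻¹≈ε
  coeff-negₚ (a ∷ p) zero    = refl
  coeff-negₚ (a ∷ p) (suc i) = coeff-negₚ p i

  ⊕-cong : ∀ {p p′ q q′} → p ≈ₚ p′ → q ≈ₚ q′ → p ⊕ q ≈ₚ p′ ⊕ q′
  ⊕-cong {p} {p′} {q} {q′} p≈p′ q≈q′ = mk λ i → begin
    coeff (p ⊕ q) i         ≈⟨ coeff-⊕ p q i ⟩
    coeff p i + coeff q i   ≈⟨ +-cong (at p≈p′ i) (at q≈q′ i) ⟩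
    coeff p′ i + coeff q′ i ≈⟨ coeff-⊕ p′ q′ i ⟨
    coeff (p′ ⊕ q′) i       ∎

  ⊕-assoc : ∀ p q r → (p ⊕ q) ⊕ r ≈ₚ p ⊕ (q ⊕ r)
  ⊕-assoc p q r = mk λ i → begin
    coeff ((p ⊕ q) ⊕ r) i               ≈⟨ coeff-⊕ (p ⊕ q) r i ⟩
    coeff (p ⊕ q) i + coeff r i         ≈⟨ +-congʳ (coeff-⊕ p q i) ⟩
    (coeff p i + coeff q i) + coeff r i ≈⟨ +-assoc _ _ _ ⟩
    coeff p i + (coeff q i + coeff r i) ≈⟨ +-congˡ (coeff-⊕ q r i) ⟨
    coeff p i + coeff (q ⊕ r) i         ≈⟨ coeff-⊕ p (q ⊕ r) i ⟨
    coeff (p ⊕ (q ⊕ r)) i               ∎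

  ⊕-comm : ∀ p q → p ⊕ q ≈ₚ q ⊕ p
  ⊕-comm p q = mk λ i → begin
    coeff (p ⊕ q) i       ≈⟨ coeff-⊕ p q i ⟩
    coeff p i + coeff q i ≈⟨ +-comm _ _ ⟩
    coeff q i + coeff p i ≈⟨ coeff-⊕ q p i ⟨
    coeff (q ⊕ p) i       ∎

  ⊕-identityʳ : ∀ p → p ⊕ [] ≈ₚ p
  ⊕-identityʳ p = mk λ i → trans (coeff-⊕ p [] i) (+-identityʳ _)

  ⊕-interchange : ∀ w x y z → (w ⊕ x) ⊕ (y ⊕ z) ≈ₚ (w ⊕ y) ⊕ (x ⊕ z)
  ⊕-interchange w x y z = mk λ i → begin
    coeff ((w ⊕ x) ⊕ (y ⊕ z)) i ≈⟨ coeff-⊕ (w ⊕ x) (y ⊕ z) i ⟩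
    coeff (w ⊕ x) i + coeff (y ⊕ z) i
      ≈⟨ +-cong (coeff-⊕ w x i) (coeff-⊕ y z i) ⟩
    (coeff w i + coeff x i) + (coeff y i + coeff z i)
      ≈⟨ interchange _ _ _ _ ⟩
    (coeff w i + coeff y i) + (coeff x i + coeff z i)
      ≈⟨ +-cong (coeff-⊕ w y i) (coeff-⊕ x z i) ⟨
    coeff (w ⊕ y) i + coeff (x ⊕ z) i ≈⟨ coeff-⊕ (w ⊕ y) (x ⊕ z) i ⟨
    coeff ((w ⊕ y) ⊕ (x ⊕ z)) i ∎
    where open import Algebra.Properties.CommutativeSemigroup +-commutativeSemigroup using (interchange)

  negₚ-cong : ∀ {p q} → p ≈ₚ q → negₚ p ≈ₚ negₚ q
  negₚ-cong {p} {q} p≈q = mk λ i →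
    trans (coeff-negₚ p i) (trans (-‿cong (at p≈q i)) (sym (coeff-negₚ q i)))

  ⊕-inverseˡ : ∀ p → negₚ p ⊕ p ≈ₚ []
  ⊕-inverseˡ p = mk λ i →
    trans (coeff-⊕ (negₚ p) p i) (trans (+-congʳ (coeff-negₚ p i)) (-‿inverseˡ _))

  ⊕-inverseʳ : ∀ p → p ⊕ negₚ p ≈ₚ []
  ⊕-inverseʳ p = mk λ i →
    trans (coeff-⊕ p (negₚ p) i) (trans (+-congˡ (coeff-negₚ p i)) (-‿inverseʳ _))

  scale-cong : ∀ {a b p q} → a ≈ b → p ≈ₚ q → scale a p ≈ₚ scale b q
  scale-cong {a} {b} {p} {q} a≈b p≈q = mk λ i →
    trans (coeff-scale a p i) (trans (*-cong a≈b (at p≈q i)) (sym (coeff-scale b q i)))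

  scale-0# : ∀ p → scale 0# p ≈ₚ []
  scale-0# p = mk λ i → trans (coeff-scale 0# p i) (zeroˡ _)

  scale-1# : ∀ p → scale 1# p ≈ₚ p
  scale-1# p = mk λ i → trans (coeff-scale 1# p i) (*-identityˡ _)

  scale-distribˡ : ∀ a p q → scale a (p ⊕ q) ≈ₚ scale a p ⊕ scale a q
  scale-distribˡ a p q = mk λ i → begin
    coeff (scale a (p ⊕ q)) i                 ≈⟨ coeff-scale a (p ⊕ q) i ⟩
    a * coeff (p ⊕ q) i                       ≈⟨ *-congˡ (coeff-⊕ p q i) ⟩
    a * (coeff p i + coeff q i)               ≈⟨ distribˡ _ _ _ ⟩
    a * coeff p i + a * coeff q i             ≈⟨ +-cong (coeff-scale a p i) (coeff-scale a q i) ⟨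
    coeff (scale a p) i + coeff (scale a q) i ≈⟨ coeff-⊕ (scale a p) (scale a q) i ⟨
    coeff (scale a p ⊕ scale a q) i           ∎

  scale-distribʳ : ∀ a b p → scale (a + b) p ≈ₚ scale a p ⊕ scale b p
  scale-distribʳ a b p = mk λ i → begin
    coeff (scale (a + b) p) i                 ≈⟨ coeff-scale (a + b) p i ⟩
    (a + b) * coeff p i                       ≈⟨ distribʳ _ _ _ ⟩
    a * coeff p i + b * coeff p i             ≈⟨ +-cong (coeff-scale a p i) (coeff-scale b p i) ⟨
    coeff (scale a p) i + coeff (scale b p) i ≈⟨ coeff-⊕ (scale a p) (scale b p) i ⟨
    coeff (scale a p ⊕ scale b p) i           ∎

  scale-assoc : ∀ a b p → scale a (scale b p) ≈ₚ scale (a * b) p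
  scale-assoc a b p = mk λ i → begin
    coeff (scale a (scale b p)) i ≈⟨ coeff-scale a (scale b p) i ⟩
    a * coeff (scale b p) i       ≈⟨ *-congˡ (coeff-scale b p i) ⟩
    a * (b * coeff p i)           ≈⟨ *-assoc _ _ _ ⟨
    (a * b) * coeff p i           ≈⟨ coeff-scale (a * b) p i ⟨
    coeff (scale (a * b) p) i     ∎

  0∷[]≈[] : 0# ∷ [] ≈ₚ []
  0∷[]≈[] = mk λ { zero → refl ; (suc i) → refl }

  0∷-⊕ : ∀ p q → 0# ∷ (p ⊕ q) ≈ₚ (0# ∷ p) ⊕ (0# ∷ q)
  0∷-⊕ p q = mk λ { zero → sym (+-identityˡ 0#) ; (suc i) → refl }

  ⊗-congʳ : ∀ p {q q′} → q ≈ₚ q′ → p ⊗ q ≈ₚ p ⊗ q′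
  ⊗-congʳ []      q≈q′ = reflₚ
  ⊗-congʳ (a ∷ p) q≈q′ = ⊕-cong (scale-cong refl q≈q′) (∷-cong refl (⊗-congʳ p q≈q′))

  ⊗-zeroʳ : ∀ p → p ⊗ [] ≈ₚ []
  ⊗-zeroʳ []      = reflₚ
  ⊗-zeroʳ (a ∷ p) = transₚ (∷-cong refl (⊗-zeroʳ p)) 0∷[]≈[]

  ⊗-∷ʳ : ∀ q a p → q ⊗ (a ∷ p) ≈ₚ scale a q ⊕ (0# ∷ (q ⊗ p))
  ⊗-∷ʳ []      a p = symₚ 0∷[]≈[]
  ⊗-∷ʳ (b ∷ q) a p = ∷-cong (+-congʳ (*-comm b a)) (transₚ
    (⊕-cong (reflₚ {scale b p}) (⊗-∷ʳ q a p))
    (transₚ (symₚ (⊕-assoc (scale b p) (scale a q) _))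
    (transₚ (⊕-cong (⊕-comm (scale b p) (scale a q)) reflₚ)
            (⊕-assoc (scale a q) (scale b p) _))))

  ⊗-comm : ∀ p q → p ⊗ q ≈ₚ q ⊗ p
  ⊗-comm []      q = symₚ (⊗-zeroʳ q)
  ⊗-comm (a ∷ p) q =
    transₚ (⊕-cong (reflₚ {scale a q}) (∷-cong refl (⊗-comm p q))) (symₚ (⊗-∷ʳ q a p))

  ⊗-cong : ∀ {p p′ q q′} → p ≈ₚ p′ → q ≈ₚ q′ → p ⊗ q ≈ₚ p′ ⊗ q′
  ⊗-cong {p} {p′} {q} {q′} p≈p′ q≈q′ =
    transₚ (⊗-comm p q) (transₚ (⊗-congʳ q p≈p′) (transₚ (⊗-comm q p′) (⊗-congʳ p′ q≈q′)))

  ⊗-distribʳ : ∀ q p p′ → (p ⊕ p′) ⊗ q ≈ₚ p ⊗ q ⊕ p′ ⊗ q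
  ⊗-distribʳ q []      p′       = reflₚ
  ⊗-distribʳ q (a ∷ p) []       = symₚ (⊕-identityʳ ((a ∷ p) ⊗ q))
  ⊗-distribʳ q (a ∷ p) (b ∷ p′) = transₚ
    (⊕-cong (scale-distribʳ a b q)
            (transₚ (∷-cong refl (⊗-distribʳ q p p′)) (0∷-⊕ (p ⊗ q) (p′ ⊗ q))))
    (⊕-interchange (scale a q) (scale b q) (0# ∷ (p ⊗ q)) (0# ∷ (p′ ⊗ q)))

  ⊗-distribˡ : ∀ q p p′ → q ⊗ (p ⊕ p′) ≈ₚ q ⊗ p ⊕ q ⊗ p′
  ⊗-distribˡ q p p′ = transₚ (⊗-comm q (p ⊕ p′))
    (transₚ (⊗-distribʳ q p p′) (⊕-cong (⊗-comm p q) (⊗-comm p′ q)))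

  scale-⊗ : ∀ a q r → scale a q ⊗ r ≈ₚ scale a (q ⊗ r)
  scale-⊗ a []      r = reflₚ
  scale-⊗ a (b ∷ q) r = transₚ
    (⊕-cong (symₚ (scale-assoc a b r)) (∷-cong (sym (zeroʳ a)) (scale-⊗ a q r)))
    (symₚ (scale-distribˡ a (scale b r) (0# ∷ (q ⊗ r))))

  ⊗-assoc : ∀ p q r → (p ⊗ q) ⊗ r ≈ₚ p ⊗ (q ⊗ r)
  ⊗-assoc []      q r = reflₚ
  ⊗-assoc (a ∷ p) q r = transₚ (⊗-distribʳ r (scale a q) (0# ∷ (p ⊗ q)))
    (⊕-cong (scale-⊗ a q r)
            (transₚ (⊕-cong (scale-0# r) reflₚ) (∷-cong refl (⊗-assoc p q r))))

  ⊗-identityˡ : ∀ p → (1# ∷ []) ⊗ p ≈ₚ p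
  ⊗-identityˡ p = transₚ (⊕-cong (scale-1# p) 0∷[]≈[]) (⊕-identityʳ p)

  ⊕-⊗-isCommutativeRing : IsCommutativeRing _≈ₚ_ _⊕_ _⊗_ negₚ [] (1# ∷ [])
  ⊕-⊗-isCommutativeRing = record
    { isRing = record
      { +-isAbelianGroup = record
        { isGroup = record
          { isMonoid = record
            { isSemigroup = record
              { isMagma = record { isEquivalence = ≈ₚ-isEquivalence ; ∙-cong = ⊕-cong }
              ; assoc = ⊕-assoc
              }
            ; identity = (λ p → reflₚ) , ⊕-identityʳ
            }
          ; inverse = ⊕-inverseˡ , ⊕-inverseʳ
          ; ⁻¹-cong = negₚ-cong
          }
        ; comm = ⊕-comm
        }
      ; *-cong = ⊗-cong
      ; *-assoc = ⊗-assoc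
      ; *-identity = ⊗-identityˡ , λ p → transₚ (⊗-comm p (1# ∷ [])) (⊗-identityˡ p)
      ; distrib = ⊗-distribˡ , ⊗-distribʳ
      }
    ; *-comm = ⊗-comm
    }

  polynomialRing : CommutativeRing 0ℓ ℓ
  polynomialRing = record { isCommutativeRing = ⊕-⊗-isCommutativeRing }

open Defs

ℤ[y] : CommutativeRing 0ℓ 0ℓ
ℤ[y] = CoefficientLists.polynomialRing ℤ.+-*-commutativeRing

ℤ[x,y] : CommutativeRing 0ℓ 0ℓ
ℤ[x,y] = CoefficientLists.polynomialRing ℤ[y]

open CommutativeRing ℤ[x,y]
  using (0#; 1#; -_; _-_)
  renaming (_≈_ to _≋_; refl to ≋-refl; sym to ≋-sym; trans to ≋-trans; reflexive to ≋-reflexive)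
module ℤ[x,y] = CommutativeRing ℤ[x,y]

≈⇒≋ : ∀ {p q} → p ≈ q → p ≋ q
≈⇒≋ p≈q = CoefficientLists.mk λ i → CoefficientLists.mk λ j → p≈q i j

≋⇒≈ : ∀ {p q} → p ≋ q → p ≈ q
≋⇒≈ p≋q i j = CoefficientLists._≈ₚ_.at (CoefficientLists._≈ₚ_.at p≋q i) j

module Solver where
  private
    const-homo : ACR._-Raw-AlmostCommutative⟶_ (CommutativeRing.rawRing ℤ.+-*-commutativeRing)
                                                 (ACR.fromCommutativeRing ℤ[x,y])
    const-homo = record
      { ⟦_⟧    = const
      ; +-homo = λ _ _ → ≋-refl
      ; *-homo = λ _ _ → ≈⇒≋ λ { zero zero → ≡.sym (ℤ.+-identityʳ _) ; zero (suc j) → ≡.refl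
                               ; (suc i) j → ≡.refl }
      ; -‿homo = λ _ → ≋-refl
      ; 0-homo = ≈⇒≋ λ { zero zero → ≡.refl ; zero (suc j) → ≡.refl ; (suc i) j → ≡.refl }
      ; 1-homo = ≋-refl
      }

    const-≟ : ∀ c d → Maybe (const c ≋ const d)
    const-≟ c d with c ℤ.≟ d
    ... | yes ≡.refl = just ≋-refl
    ... | no _       = nothing

  open import Algebra.Solver.Ring _ _ const-homo const-≟ public

open Solver using (solve; _:=_; _:+_; _:*_; _:-_; :-_; con)

ι : ℕ → Poly
ι n = const (+ n)

ι0≋0# : ι 0 ≋ 0#
ι0≋0# = ≈⇒≋ λ { zero zero → ≡.refl ; zero (suc j) → ≡.refl ; (suc i) j → ≡.refl }

^-+ : ∀ x m n → x ^ (m ℕ.+ n) ≋ x ^ m * x ^ n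
^-+ x zero    n = ≋-sym (ℤ[x,y].*-identityˡ _)
^-+ x (suc m) n = ≋-trans (ℤ[x,y].*-congˡ {x} (^-+ x m n)) (≋-sym (ℤ[x,y].*-assoc x (x ^ m) (x ^ n)))

∑< : ℕ → (ℕ → Poly) → Poly
∑< N f = sumL (applyUpTo f N)

Σ[to]≋∑< : ∀ lo hi f → Σ[ lo to hi ] f ≋ ∑< (suc hi ∸ lo) (λ t → f (lo ℕ.+ t))
Σ[to]≋∑< lo hi f = ≋-reflexive (≡.cong sumL (map-upTo (λ t → f (lo ℕ.+ t)) (suc hi ∸ lo)))

∑<-cong : ∀ {f g} N → (∀ t → f t ≋ g t) → ∑< N f ≋ ∑< N g
∑<-cong zero    f≋g = ≋-refl
∑<-cong (suc N) f≋g = ℤ[x,y].+-cong (f≋g 0) (∑<-cong N (λ t → f≋g (suc t)))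

∑<-suc : ∀ f N → ∑< (suc N) f ≋ ∑< N f + f N
∑<-suc f zero    = ℤ[x,y].+-comm (f 0) 0#
∑<-suc f (suc N) = ≋-trans (ℤ[x,y].+-congˡ {f 0} (∑<-suc (λ t → f (suc t)) N))
                           (≋-sym (ℤ[x,y].+-assoc (f 0) _ (f (suc N))))

∑<-+ : ∀ f M N → ∑< (M ℕ.+ N) f ≋ ∑< M f + ∑< N (λ t → f (M ℕ.+ t))
∑<-+ f zero    N = ≋-sym (ℤ[x,y].+-identityˡ _)
∑<-+ f (suc M) N = ≋-trans (ℤ[x,y].+-congˡ (∑<-+ (λ t → f (suc t)) M N))
                           (≋-sym (ℤ[x,y].+-assoc (f 0) _ _))

∑<-distribˡ : ∀ c f N → ∑< N (λ t → c * f t) ≋ c * ∑< N f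
∑<-distribˡ c f zero    = ≋-sym (ℤ[x,y].zeroʳ c)
∑<-distribˡ c f (suc N) = ≋-trans (ℤ[x,y].+-congˡ (∑<-distribˡ c (λ t → f (suc t)) N))
                                  (≋-sym (ℤ[x,y].distribˡ c (f 0) _))

geom : Poly → ℕ → Poly
geom b N = ∑< N (b ^_)

geom-suc : ∀ b N → geom b (suc N) ≋ 1# + b * geom b N
geom-suc b N = ℤ[x,y].+-congˡ (∑<-distribˡ b (b ^_) N)

geom-+ : ∀ b M N → geom b (M ℕ.+ N) ≋ geom b M + b ^ M * geom b N
geom-+ b M N = ≋-trans (∑<-+ (b ^_) M N)
  (ℤ[x,y].+-congˡ (≋-trans (∑<-cong N (^-+ b M)) (∑<-distribˡ (b ^ M) (b ^_) N)))

Σ[0to]≋geom : ∀ b N → Σ[ 0 to N ] (b ^_) ≋ geom b (suc N)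
Σ[0to]≋geom b N = Σ[to]≋∑< 0 N (b ^_)

record IsIdeal (I : Poly → Set) : Set where
  field
    ≋-resp   : ∀ {x y} → x ≋ y → I x → I y
    0∈       : I 0#
    +-closed : ∀ {x y} → I x → I y → I (x + y)
    *-closed : ∀ c {x} → I x → I (c * x)

  combination₀ : ∀ {x} → x ≋ ι 0 → I x
  combination₀ x≋0 = ≋-resp (≋-sym (≋-trans x≋0 ι0≋0#)) 0∈

  combination₁ : ∀ {x g} r → I g → x ≋ r * g → I x
  combination₁ r g∈ x≋ = ≋-resp (≋-sym x≋) (*-closed r g∈)

  combination₂ : ∀ {x g h} r s → I g → I h → x ≋ r * g + s * h → I x
  combination₂ r s g∈ h∈ x≋ = ≋-resp (≋-sym x≋) (+-closed (*-closed r g∈) (*-closed s h∈))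

  combination₃ : ∀ {x g h l} r s t → I g → I h → I l → x ≋ r * g + s * h + t * l → I x
  combination₃ r s t g∈ h∈ l∈ x≋ =
    ≋-resp (≋-sym x≋) (+-closed (+-closed (*-closed r g∈) (*-closed s h∈)) (*-closed t l∈))

  combination₄ : ∀ {x g h l o} r s t v → I g → I h → I l → I o →
                 x ≋ r * g + s * h + t * l + v * o → I x
  combination₄ r s t v g∈ h∈ l∈ o∈ x≋ = ≋-resp (≋-sym x≋)
    (+-closed (+-closed (+-closed (*-closed r g∈) (*-closed s h∈)) (*-closed t l∈)) (*-closed v o∈))

linearCombination : List Poly → List Poly → Poly
linearCombination rs gs = sumL (zipWith _*_ rs gs)

linearCombination-+ : ∀ rs ss gs → Σ[ ts ∈ List Poly ]
  linearCombination ts gs ≋ linearCombination rs gs + linearCombination ss gs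
linearCombination-+ []       ss       gs       = ss , ≋-sym (ℤ[x,y].+-identityˡ _)
linearCombination-+ (r ∷ rs) []       gs       = r ∷ rs , ≋-sym (ℤ[x,y].+-identityʳ _)
linearCombination-+ (r ∷ rs) (s ∷ ss) []       = [] , ≋-sym (ℤ[x,y].+-identityʳ 0#)
linearCombination-+ (r ∷ rs) (s ∷ ss) (g ∷ gs) with linearCombination-+ rs ss gs
... | ts , ts≋ = r + s ∷ ts , ≋-trans (ℤ[x,y].+-cong (ℤ[x,y].distribʳ g r s) ts≋)
                                      (interchange (r * g) (s * g) _ _)
  where open import Algebra.Properties.CommutativeSemigroup ℤ[x,y].+-commutativeSemigroup
          using (interchange)

linearCombination-scale : ∀ c rs gs →
  linearCombination (map (c *_) rs) gs ≋ c * linearCombination rs gs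
linearCombination-scale c []       gs       = ≋-sym (ℤ[x,y].zeroʳ c)
linearCombination-scale c (r ∷ rs) []       = ≋-sym (ℤ[x,y].zeroʳ c)
linearCombination-scale c (r ∷ rs) (g ∷ gs) = ≋-trans
  (ℤ[x,y].+-cong (ℤ[x,y].*-assoc c r g) (linearCombination-scale c rs gs))
  (≋-sym (ℤ[x,y].distribˡ c (r * g) _))

∈⇒linearCombination : ∀ {g gs} → g ∈ gs → Σ[ rs ∈ List Poly ] g ≋ linearCombination rs gs
∈⇒linearCombination {g} (here ≡.refl) =
  1# ∷ [] , ≋-sym (≋-trans (ℤ[x,y].+-identityʳ _) (ℤ[x,y].*-identityˡ g))
∈⇒linearCombination {gs = h ∷ gs} (there g∈gs) with ∈⇒linearCombination g∈gs
... | rs , g≋ = 0# ∷ rs ,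
  ≋-trans g≋ (≋-sym (≋-trans (ℤ[x,y].+-congʳ (ℤ[x,y].zeroˡ h)) (ℤ[x,y].+-identityˡ _)))

≋⇒InIdeal : ∀ {h gs} rs → h ≋ linearCombination rs gs → InIdeal h gs
≋⇒InIdeal rs h≋ = rs , ≋⇒≈ h≋

InIdeal-isIdeal : ∀ gs → IsIdeal (λ h → InIdeal h gs)
InIdeal-isIdeal gs = record
  { ≋-resp   = λ { {x} {y} x≋y (rs , x≈) →
                   ≋⇒InIdeal rs (≋-trans (≋-sym x≋y) (≈⇒≋ {x} {linearCombination rs gs} x≈)) }
  ; 0∈       = ≋⇒InIdeal [] ≋-refl
  ; +-closed = λ {x} {y} → +-closed {x} {y}
  ; *-closed = λ { c {x} (rs , x≈) → ≋⇒InIdeal (map (c *_) rs)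
                   (≋-trans (ℤ[x,y].*-congˡ {c} (≈⇒≋ {x} {linearCombination rs gs} x≈))
                            (≋-sym (linearCombination-scale c rs gs))) }
  }
  where
  +-closed : ∀ {x y} → InIdeal x gs → InIdeal y gs → InIdeal (x + y) gs
  +-closed {x} {y} (rs , x≈) (ss , y≈) with linearCombination-+ rs ss gs
  ... | ts , ts≋ = ≋⇒InIdeal ts (≋-trans (ℤ[x,y].+-cong (≈⇒≋ {x} {linearCombination rs gs} x≈)
                                                         (≈⇒≋ {y} {linearCombination ss gs} y≈))
                                         (≋-sym ts≋))

generator∈InIdeal : ∀ {g gs} → g ∈ gs → InIdeal g gs
generator∈InIdeal g∈gs = let rs , g≋ = ∈⇒linearCombination g∈gs in ≋⇒InIdeal rs g≋

data EvenOrOdd : ℕ → Set where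
  even : ∀ p → EvenOrOdd (p ℕ.+ p)
  odd  : ∀ p → EvenOrOdd (suc (p ℕ.+ p))

evenOrOdd : ∀ n → EvenOrOdd n
evenOrOdd zero = even 0
evenOrOdd (suc n) with evenOrOdd n
... | even p = odd p
... | odd p  = ≡.subst EvenOrOdd (≡.cong suc (ℕ.+-suc p p)) (even (suc p))

[1+n]/2≡⌈n/2⌉ : ∀ n → suc n ℕ./ 2 ≡ ⌈ n /2⌉
[1+n]/2≡⌈n/2⌉ zero          = ≡.refl
[1+n]/2≡⌈n/2⌉ (suc zero)    = ≡.refl
[1+n]/2≡⌈n/2⌉ (suc (suc n)) =
  ≡.trans (m/n≡1+[m∸n]/n {suc (suc (suc n))} (s≤s (s≤s z≤n))) (≡.cong suc ([1+n]/2≡⌈n/2⌉ n))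

module Reduction {I : Poly → Set} (isIdeal : IsIdeal I) (a b : Poly)
  (a+1·u∈I : I ((a + 1#) * (a * b - 1#)))
  (b+1·u∈I : I ((b + 1#) * (a * b - 1#))) where
  open IsIdeal isIdeal

  u : Poly
  u = a * b - 1#

  infix 4 _∼_
  _∼_ : Poly → Poly → Set
  x ∼ y = I (x - y)

  posPowers : ℕ → Poly
  posPowers j = ∑< (suc j) (λ t → a ^ suc t)

  mixed-power : ∀ i → b ^ i * a ^ suc i ∼ a - ι i * u
  mixed-power zero = combination₀ (solve 2 (λ a b →
    con (+ 1) :* (a :* con (+ 1)) :- (a :- con (+ 0) :* (a :* b :- con (+ 1))) := con (+ 0))
    ≋-refl a b)
  mixed-power (suc i) =
    combination₃ (a * b) (1# + ι i) (- (ι i * a)) (mixed-power i) a+1·u∈I b+1·u∈I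
      (solve 5 (λ a b A B c → let U = a :* b :- con (+ 1) in
        b :* B :* (a :* A) :- (a :- (con (+ 1) :+ c) :* U)
        := (a :* b) :* (B :* A :- (a :- c :* U)) :+ (con (+ 1) :+ c) :* ((a :+ con (+ 1)) :* U)
           :+ (:- (c :* a)) :* ((b :+ con (+ 1)) :* U))
        ≋-refl a b (a ^ suc i) (b ^ i) (ι i))

  telescope : ∀ j → b ^ j * posPowers j + ι ⌊ j /2⌋ * u ∼ geom b j + a
  telescope zero = combination₀ (solve 3 (λ a b z →
    con (+ 1) :* (a :* con (+ 1) :+ z) :+ con (+ 0) :* (a :* b :- con (+ 1)) :- (z :+ a)
    := con (+ 0)) ≋-refl a b 0#)
  telescope (suc j) =
    combination₄ b (a * b) (1# + (f₀ + f₁)) (- (f₀ + (f₀ + f₁) * a))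
      (telescope j) mixed a+1·u∈I b+1·u∈I
      (≋-trans unfold (solve 8 (λ a b A B T S f₀ f₁ → let U = a :* b :- con (+ 1) in
        b :* B :* (T :+ a :* A) :+ f₁ :* U :- ((con (+ 1) :+ b :* S) :+ a)
        := b :* (B :* T :+ f₀ :* U :- (S :+ a)) :+ (a :* b) :* (B :* A :- (a :- (f₀ :+ f₁) :* U))
           :+ (con (+ 1) :+ (f₀ :+ f₁)) :* ((a :+ con (+ 1)) :* U)
           :+ (:- (f₀ :+ (f₀ :+ f₁) :* a)) :* ((b :+ con (+ 1)) :* U))
        ≋-refl a b (a ^ suc j) (b ^ j) (posPowers j) (geom b j) f₀ f₁))
    where
    f₀ f₁ : Poly
    f₀ = ι ⌊ j /2⌋
    f₁ = ι ⌈ j /2⌉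

    mixed : b ^ j * a ^ suc j ∼ a - (f₀ + f₁) * u
    mixed = ≡.subst (λ c → b ^ j * a ^ suc j ∼ a - ι c * u)
                    (≡.sym (ℕ.⌊n/2⌋+⌈n/2⌉≡n j)) (mixed-power j)

    unfold : b ^ suc j * posPowers (suc j) + f₁ * u - (geom b (suc j) + a)
           ≋ b ^ suc j * (posPowers j + a * a ^ suc j) + f₁ * u - ((1# + b * geom b j) + a)
    unfold = ℤ[x,y].+-cong (ℤ[x,y].+-congʳ (ℤ[x,y].*-congˡ {b ^ suc j} (∑<-suc (λ t → a ^ suc t) (suc j))))
                           (ℤ[x,y].-‿cong (ℤ[x,y].+-congʳ {a} (geom-suc b j)))

  even-power-u : ∀ p → b ^ (p ℕ.+ p) * u ∼ u
  even-power-u zero = combination₀ (solve 2 (λ a b →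
    con (+ 1) :* (a :* b :- con (+ 1)) :- (a :* b :- con (+ 1)) := con (+ 0)) ≋-refl a b)
  even-power-u (suc p) rewrite ℕ.+-suc p p =
    combination₂ (b * b) (b - 1#) (even-power-u p) b+1·u∈I
      (solve 3 (λ a b B → let U = a :* b :- con (+ 1) in
        b :* (b :* B) :* U :- U := (b :* b) :* (B :* U :- U) :+ (b :- con (+ 1)) :* ((b :+ con (+ 1)) :* U))
        ≋-refl a b (b ^ (p ℕ.+ p)))

  geom-even-u : ∀ q → I (geom b (q ℕ.+ q) * u)
  geom-even-u zero = ≋-resp (≋-sym (ℤ[x,y].zeroˡ u)) 0∈
  geom-even-u (suc q) rewrite ℕ.+-suc q q =
    combination₂ 1# (b ^ (q ℕ.+ q)) (geom-even-u q) b+1·u∈I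
      (≋-trans (ℤ[x,y].*-congʳ (≋-trans (∑<-suc (b ^_) (suc (q ℕ.+ q)))
                                         (ℤ[x,y].+-congʳ (∑<-suc (b ^_) (q ℕ.+ q)))))
        (solve 4 (λ a b S B → let U = a :* b :- con (+ 1) in
          ((S :+ B) :+ b :* B) :* U := con (+ 1) :* (S :* U) :+ B :* ((b :+ con (+ 1)) :* U))
          ≋-refl a b (geom b (q ℕ.+ q)) (b ^ (q ℕ.+ q))))

  -- As b u ≡ −u, both sides agree for even n and differ by n u for odd n.
  halves : ∀ n → I (ι n * u) → ι ⌊ n /2⌋ * u ∼ ι ⌈ n /2⌉ * (b ^ n * u)
  halves n n·u∈I with evenOrOdd n
  ... | even p rewrite ≡.sym (ℕ.n≡⌊n+n/2⌋ p) | ≡.sym (ℕ.n≡⌈n+n/2⌉ p) =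
    combination₁ (- ι p) (even-power-u p)
      (solve 4 (λ a b B c → let U = a :* b :- con (+ 1) in
        c :* U :- c :* (B :* U) := (:- c) :* (B :* U :- U))
        ≋-refl a b (b ^ (p ℕ.+ p)) (ι p))
  ... | odd p rewrite ≡.sym (ℕ.n≡⌊n+n/2⌋ p) | ≡.sym (ℕ.n≡⌈n+n/2⌉ p) =
    combination₃ 1# (- (1# + ι p) * b) (- (1# + ι p)) n·u∈I (even-power-u p) b+1·u∈I
      (solve 4 (λ a b B c → let U = a :* b :- con (+ 1) in
        c :* U :- (con (+ 1) :+ c) :* (b :* B :* U)
        := con (+ 1) :* ((con (+ 1) :+ (c :+ c)) :* U) :+ (:- (con (+ 1) :+ c) :* b) :* (B :* U :- U)
           :+ (:- (con (+ 1) :+ c)) :* ((b :+ con (+ 1)) :* U))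
        ≋-refl a b (b ^ (p ℕ.+ p)) (ι p))

  -- b^n · C-form − telescope n ≡ geom b (2n + 3) + a, up to the halves relation.
  odd-geom+a : ∀ n → I (ι n * u) →
               I (geom b (3 ℕ.+ n) + posPowers n + ι ⌈ n /2⌉ * u) →
               I (geom b (suc (suc n ℕ.+ suc n)) + a)
  odd-geom+a n n·u∈I c∈I = ≡.subst (λ N → I (geom b N + a)) n+[3+n]≡1+[1+n+1+n]
    (combination₃ (b ^ n) (- 1#) 1# c∈I (telescope n) (halves n n·u∈I)
      (≋-trans (ℤ[x,y].+-congʳ (geom-+ b n (3 ℕ.+ n)))
        (solve 8 (λ a b S Bn S₃ T f₀ m → let U = a :* b :- con (+ 1) in
          S :+ Bn :* S₃ :+ a
          := Bn :* (S₃ :+ T :+ m :* U) :+ (:- con (+ 1)) :* (Bn :* T :+ f₀ :* U :- (S :+ a))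
             :+ con (+ 1) :* (f₀ :* U :- m :* (Bn :* U)))
          ≋-refl a b (geom b n) (b ^ n) (geom b (3 ℕ.+ n)) (posPowers n) (ι ⌊ n /2⌋) (ι ⌈ n /2⌉))))
    where
    n+[3+n]≡1+[1+n+1+n] : n ℕ.+ (3 ℕ.+ n) ≡ suc (suc n ℕ.+ suc n)
    n+[3+n]≡1+[1+n+1+n] = ≡.trans (ℕ.+-suc n (2 ℕ.+ n)) (≡.cong suc (ℕ.+-suc n (suc n)))

  even-power+a·geom : ∀ q → I (geom b (suc (q ℕ.+ q)) + a) →
                      I (b ^ (q ℕ.+ q) + a * geom b (suc (q ℕ.+ q)))
  even-power+a·geom q h∈I = combination₂ 1# 1# h′∈I (geom-even-u q)
    (≋-trans (ℤ[x,y].+-congˡ {b ^ (q ℕ.+ q)} (ℤ[x,y].*-congˡ {a} (geom-suc b (q ℕ.+ q))))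
      (solve 4 (λ a b S B → let U = a :* b :- con (+ 1) in
        B :+ a :* (con (+ 1) :+ b :* S) := con (+ 1) :* ((S :+ B) :+ a) :+ con (+ 1) :* (S :* U))
        ≋-refl a b (geom b (q ℕ.+ q)) (b ^ (q ℕ.+ q))))
    where
    h′∈I : I ((geom b (q ℕ.+ q) + b ^ (q ℕ.+ q)) + a)
    h′∈I = ≋-resp (ℤ[x,y].+-congʳ (∑<-suc (b ^_) (q ℕ.+ q))) h∈I

  reduction : ∀ n → I (ι n * u) → I (geom b (3 ℕ.+ n) + posPowers n + ι ⌈ n /2⌉ * u) →
              let N = suc n ℕ.+ suc n in
              I (geom b (suc N) + a) × I (b ^ N + a * geom b (suc N))
  reduction n n·u∈I c∈I = odd∈I , even-power+a·geom (suc n) odd∈I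
    where
    odd∈I : I (geom b (suc (suc n ℕ.+ suc n)) + a)
    odd∈I = odd-geom+a n n·u∈I c∈I

module Proposition6 (n : ℕ) where
  private
    k N : ℕ
    k = suc (suc n)
    N = suc n ℕ.+ suc n

    2k∸2≡N : 2 ℕ.* k ∸ 2 ≡ N
    2k∸2≡N rewrite ℕ.+-identityʳ n = ℕ.+-suc n (suc n)

    ⟨C⟩ : Poly → Set
    ⟨C⟩ h = InIdeal h (gens k)

    open IsIdeal (InIdeal-isIdeal (gens k)) using (≋-resp)

    C-form : Poly → Poly → Poly
    C-form a b = geom b (3 ℕ.+ n) + ∑< (suc n) (λ t → a ^ suc t) + ι ⌈ n /2⌉ * (a * b - 1#)

    C-shape : ∀ {S S′ T T′} → S ≋ S′ → T ≋ T′ →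
              S + T + const (+ m k) * X * Y + const (ℤ.- (+ m k)) ≋ S′ + T′ + ι ⌈ n /2⌉ * (X * Y - 1#)
    C-shape {S} {S′} {T} {T′} S≋S′ T≋T′ =
      ≡.subst (λ c → S + T + const (+ m k) * X * Y + const (ℤ.- (+ m k)) ≋ S′ + T′ + ι c * (X * Y - 1#))
        ([1+n]/2≡⌈n/2⌉ n) (≋-trans
        (ℤ[x,y].+-cong (ℤ[x,y].+-cong (ℤ[x,y].+-cong S≋S′ T≋T′) ≋-refl) ≋-refl)
        (solve 5 (λ S T c x y → S :+ T :+ c :* x :* y :+ (:- c) := S :+ T :+ c :* (x :* y :- con (+ 1)))
          ≋-refl S′ T′ (ι (m k)) X Y))

    u-comm : X * Y - 1# ≋ Y * X - 1#
    u-comm = ℤ[x,y].+-cong (ℤ[x,y].*-comm X Y) (≋-refl { - 1# })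

    C₁≋ : C₁ k ≋ C-form X Y
    C₁≋ = C-shape (Σ[to]≋∑< 0 k (Y ^_)) (Σ[to]≋∑< 1 (k ∸ 1) (X ^_))

    C₂≋ : C₂ k ≋ C-form Y X
    C₂≋ = ≋-trans (C-shape (Σ[to]≋∑< 0 k (X ^_)) (Σ[to]≋∑< 1 (k ∸ 1) (Y ^_)))
      (ℤ[x,y].+-cong (≋-refl {geom X (3 ℕ.+ n) + ∑< (suc n) (λ t → Y ^ suc t)})
                     (ℤ[x,y].*-cong (≋-refl {ι ⌈ n /2⌉}) u-comm))

    C₃≋ : C₃ k ≋ (X + 1#) * (X * Y - 1#)
    C₃≋ = solve 2 (λ x y →
      x :* (x :* con (+ 1)) :* y :+ x :* y :+ con (ℤ.- (+ 1)) :* x :+ con (ℤ.- (+ 1))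
      := (x :+ con (+ 1)) :* (x :* y :- con (+ 1))) ≋-refl X Y

    C₄≋ : C₄ k ≋ (Y + 1#) * (X * Y - 1#)
    C₄≋ = solve 2 (λ x y →
      x :* (y :* (y :* con (+ 1))) :+ x :* y :+ con (ℤ.- (+ 1)) :* y :+ con (ℤ.- (+ 1))
      := (y :+ con (+ 1)) :* (x :* y :- con (+ 1))) ≋-refl X Y

    C₅≋ : C₅ k ≋ ι n * (X * Y - 1#)
    C₅≋ = solve 3 (λ c x y → c :* x :* y :+ (:- c) := c :* (x :* y :- con (+ 1))) ≋-refl (ι n) X Y

    C₁∈ : ⟨C⟩ (C-form X Y)
    C₁∈ = ≋-resp C₁≋ (generator∈InIdeal (here ≡.refl))
    C₂∈ : ⟨C⟩ (C-form Y X)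
    C₂∈ = ≋-resp C₂≋ (generator∈InIdeal (there (here ≡.refl)))
    C₃∈ : ⟨C⟩ ((X + 1#) * (X * Y - 1#))
    C₃∈ = ≋-resp C₃≋ (generator∈InIdeal (there (there (here ≡.refl))))
    C₄∈ : ⟨C⟩ ((Y + 1#) * (X * Y - 1#))
    C₄∈ = ≋-resp C₄≋ (generator∈InIdeal (there (there (there (here ≡.refl)))))
    C₅∈ : ⟨C⟩ (ι n * (X * Y - 1#))
    C₅∈ = ≋-resp C₅≋ (generator∈InIdeal (there (there (there (there (here ≡.refl))))))

    swap-u : ∀ c → ⟨C⟩ (c * (X * Y - 1#)) → ⟨C⟩ (c * (Y * X - 1#))
    swap-u c = ≋-resp (ℤ[x,y].*-cong (≋-refl {c}) u-comm)

    H₁≋ : H₁ k ≋ geom Y (suc N) + X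
    H₁≋ = ≡.subst (λ M → H₁ k ≋ geom Y (suc M) + X) 2k∸2≡N
      (ℤ[x,y].+-cong (Σ[0to]≋geom Y (2 ℕ.* k ∸ 2)) (≋-refl {X}))

    H₂≋ : H₂ k ≋ Y ^ N + X * geom Y (suc N)
    H₂≋ = ≡.subst (λ M → H₂ k ≋ Y ^ M + X * geom Y (suc M)) 2k∸2≡N
      (ℤ[x,y].+-cong (≋-refl {Y ^ (2 ℕ.* k ∸ 2)})
                     (ℤ[x,y].*-cong (≋-refl {X}) (Σ[0to]≋geom Y (2 ℕ.* k ∸ 2))))

    H₃≋ : H₃ k ≋ geom X (suc N) + Y
    H₃≋ = ≡.subst (λ M → H₃ k ≋ geom X (suc M) + Y) 2k∸2≡N
      (≋-trans (ℤ[x,y].+-cong (≋-refl {Y}) (Σ[0to]≋geom X (2 ℕ.* k ∸ 2)))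
               (ℤ[x,y].+-comm Y (geom X (suc (2 ℕ.* k ∸ 2)))))

    H₄≋ : H₄ k ≋ X ^ N + Y * geom X (suc N)
    H₄≋ = ≡.subst (λ M → H₄ k ≋ X ^ M + Y * geom X (suc M)) 2k∸2≡N
      (≋-trans (ℤ[x,y].+-cong (ℤ[x,y].*-cong (≋-refl {Y}) (Σ[0to]≋geom X (2 ℕ.* k ∸ 2)))
                              (≋-refl {X ^ (2 ℕ.* k ∸ 2)}))
               (ℤ[x,y].+-comm (Y * geom X (suc (2 ℕ.* k ∸ 2))) (X ^ (2 ℕ.* k ∸ 2))))

    module XY = Reduction (InIdeal-isIdeal (gens k)) X Y C₃∈ C₄∈
    module YX = Reduction (InIdeal-isIdeal (gens k)) Y X
                          (swap-u (Y + 1#) C₄∈) (swap-u (X + 1#) C₃∈)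

  H∈⟨C⟩ : InIdeal (H₁ k) (gens k) × InIdeal (H₂ k) (gens k)
          × InIdeal (H₃ k) (gens k) × InIdeal (H₄ k) (gens k)
  H∈⟨C⟩ =
    let H₁∈ , H₂∈ = XY.reduction n C₅∈ C₁∈
        H₃∈ , H₄∈ = YX.reduction n (swap-u (ι n) C₅∈) C₂∈
    in ≋-resp (≋-sym H₁≋) H₁∈ , ≋-resp (≋-sym H₂≋) H₂∈
     , ≋-resp (≋-sym H₃≋) H₃∈ , ≋-resp (≋-sym H₄≋) H₄∈

proposition6 : (k : ℕ) → 4 ≤ k →
    InIdeal (H₁ k) (gens k) × InIdeal (H₂ k) (gens k)
    × InIdeal (H₃ k) (gens k) × InIdeal (H₄ k) (gens k)
proposition6 (suc (suc n)) _ = Proposition6.H∈⟨C⟩ n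
proposition6 1 (s≤s ())
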